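{- Let $G$ be a connected graph and $n\ge 1$. Then player B wins the general position avoidance game on the lexicographic product $G\circ K_n$ if and only if player B wins the general position avoidance game on $G$ and $n$ is odd.
   Context: The lexicographic product $G\circ H$ has vertex set $V(G)\times V(H)$, with $(g,h)$ adjacent to $(g',h')$ iff either $gg'\in E(G)$, or $g=g'$ and $hh'\in E(H)$. A set $S$ of vertices of a graph is a general position set if no three distinct vertices of $S$ lie on a common shortest path. In the general position avoidance game on a graph, players A and B alternately select vertices, with A moving first; a selection is legal if the vertex was not selected before and the set of all selected vertices is a general position set. The game ends when no legal move remains, and the player who selects the last vertex loses. "Player X wins" means X has a winning strategy. -}

module Defs where

open import Data.Nat using (ℕ; suc; _+_; _*_; _≤_)
open import Data.Fin using (Fin)
open import Data.List using (List; []; _∷_; length)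
open import Data.List.Membership.Propositional using (_∈_; _∉_)
open import Data.Product using (_×_; _,_; ∃; ∃-syntax; Σ-syntax)
open import Data.Sum using (_⊎_; inj₁; inj₂)
open import Relation.Nullary using (¬_)
open import Relation.Binary.PropositionalEquality using (_≡_; refl) renaming (sym to ≡-sym)

record Graph (V : Set) : Set₁ where
  field
    Adj    : V → V → Set
    sym    : ∀ {u v} → Adj u v → Adj v u
    irrefl : ∀ {u} → ¬ Adj u u
open Graph public

module _ {V : Set} (G : Graph V) where

  data Walk : V → V → Set where
    here : (u : V) → Walk u u
    step : ∀ {u w v} → Adj G u w → Walk w v → Walk u v

  len : ∀ {u v} → Walk u v → ℕ
  len (here _)   = 0
  len (step _ p) = suc (len p)

  verts : ∀ {u v} → Walk u v → List V
  verts (here u)       = u ∷ []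
  verts {u} (step _ p) = u ∷ verts p

  IsGeodesic : ∀ {u v} → Walk u v → Set
  IsGeodesic {u} {v} p = ∀ (q : Walk u v) → len p ≤ len q

  OnCommonGeodesic : V → V → V → Set
  OnCommonGeodesic x y z =
    ∃[ u ] ∃[ v ] Σ[ p ∈ Walk u v ]
      (IsGeodesic p × x ∈ verts p × y ∈ verts p × z ∈ verts p)

  GeneralPosition : List V → Set
  GeneralPosition S = ∀ x y z → x ∈ S → y ∈ S → z ∈ S →
    ¬ x ≡ y → ¬ y ≡ z → ¬ x ≡ z → ¬ OnCommonGeodesic x y z

  Connected : Set
  Connected = V × (∀ u v → Walk u v)

  Legal : List V → V → Set
  Legal S v = v ∉ S × GeneralPosition (v ∷ S)

  -- General position avoidance game (the player selecting the last vertex loses).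
  -- If no legal move remains, the previous player selected the last vertex,
  -- so the player to move wins.
  data ToMoveWins  (S : List V) : Set
  data ToMoveLoses (S : List V) : Set

  data ToMoveWins S where
    noMove : (∀ v → ¬ Legal S v) → ToMoveWins S
    move   : (v : V) → Legal S v → ToMoveLoses (v ∷ S) → ToMoveWins S

  data ToMoveLoses S where
    allMoves : (∃[ v ] Legal S v) →
               (∀ v → Legal S v → ToMoveWins (v ∷ S)) → ToMoveLoses S

  -- Player A moves first from the empty position; B wins iff A (to move) loses.
  BWins : Set
  BWins = ToMoveLoses []

K : (n : ℕ) → Graph (Fin n)
Adj (K n) i j = ¬ i ≡ j
sym (K n) p q = p (≡-sym q)
irrefl (K n) p = p refl

_∘ₗ_ : {V W : Set} → Graph V → Graph W → Graph (V × W)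
Adj (G ∘ₗ H) (g , h) (g' , h') = Adj G g g' ⊎ (g ≡ g' × Adj H h h')
sym (G ∘ₗ H) (inj₁ a) = inj₁ (sym G a)
sym (G ∘ₗ H) (inj₂ (refl , a)) = inj₂ (refl , sym H a)
irrefl (G ∘ₗ H) (inj₁ a) = irrefl G a
irrefl (G ∘ₗ H) (inj₂ (_ , a)) = irrefl H a

Odd : ℕ → Set
Odd n = ∃[ k ] n ≡ 1 + 2 * k

{-# OPTIONS --safe #-}
module Submission where

-- In G ∘ K n two vertices of one fibre never lie on a geodesic together with a third
-- vertex, and geodesics joining different fibres project to, and lift from, geodesics of
-- G.  Hence a set is in general position iff its set of fibres is in general position in
-- G: a move into an occupied fibre is always legal, and a move into a new fibre is a move
-- of the game on G.
--
-- If n is even, pair up the vertices of every fibre.  The first player opens a new pair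
-- whenever all played pairs are complete and otherwise answers each move by its partner.
-- After each of her moves only the pair she opened is incomplete, and the second player
-- may complete it, so she never makes the last move.
--
-- If n is odd, fix in every occupied fibre the first vertex played there and pair up the
-- remaining n - 1 vertices.  A move inside an occupied fibre can always be answered by
-- its partner, so such moves cancel out and only moves into new fibres matter: a winning
-- strategy on G, played on the fibres, wins on G ∘ K n, and a winning strategy on G ∘ K n,
-- read off on the fibres, wins on G.

open import Defs
open import Data.Empty using (⊥-elim)
open import Data.Fin using (Fin; zero; suc)
import Data.Fin as Fin
open import Data.Fin.Permutation.Components using (transpose; transpose-inverse)
import Data.Fin.Properties as Finₚ
open import Data.List using (List; []; _∷_; map; allFin; cartesianProduct)
open import Data.List.Membership.Propositional using (_∈_; _∉_; lose)
open import Data.List.Membership.Propositional.Properties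
  using (∈-map⁺; ∈-map⁻; ∈-allFin; ∈-cartesianProduct⁺)
import Data.List.Membership.DecPropositional as DecMembership
open import Data.List.Relation.Binary.Subset.Propositional using (_⊆_)
open import Data.List.Relation.Binary.Subset.Propositional.Properties using (∈-∷⁺ʳ; ∷⁺ʳ)
open import Data.List.Relation.Unary.Any using (here; there; satisfied)
  renaming (any? to anyᴸ?)
open import Data.Nat using (ℕ; zero; suc; _+_; _≤_; _<_; z≤n; s≤s)
open import Data.Nat.Induction using (<-wellFounded)
open import Data.Nat.Properties
  using (≤-trans; ≤-refl; ≤-reflexive; ≤-<-trans; <⇒≱; <-irrefl; m≤n⇒m≤1+n; m<n⇒m<1+n;
         *-suc; suc-injective)
open import Data.Product using (_×_; _,_; proj₁; proj₂; map₂; Σ-syntax; ∃-syntax)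
open import Data.Product.Properties using (≡-dec)
open import Data.Sum using (_⊎_; inj₁; inj₂)
open import Function using (_∘_)
open import Function.Bundles using (_⇔_; mk⇔; Equivalence)
open import Induction.WellFounded using (Acc; acc)
open import Relation.Binary.Definitions using (DecidableEquality)
open import Relation.Binary.PropositionalEquality
  using (_≡_; _≢_; refl; cong; subst; trans; module ≡-Reasoning) renaming (sym to ≡-sym)
open import Relation.Nullary using (¬_; Dec; yes; no; ¬?; contradiction)
open import Relation.Nullary.Decidable using (_×-dec_; dec-true)

module _ {V : Set} (H : Graph V) where

  start∈verts : ∀ {u v} (p : Walk H u v) → u ∈ verts H p
  start∈verts (here u)   = here refl
  start∈verts (step _ p) = here refl

  suffix : ∀ {u v x} (p : Walk H u v) → x ∈ verts H p →
    Σ[ s ∈ Walk H x v ] len H s ≤ len H p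
  suffix p@(here _)   (here refl) = p , ≤-refl
  suffix p@(step _ _) (here refl) = p , ≤-refl
  suffix (step _ p)   (there x∈p) with suffix p x∈p
  ... | s , s≤p = s , m≤n⇒m≤1+n s≤p

  substWalk : ∀ {u u' v v'} → u ≡ u' → v ≡ v' → (p : Walk H u v) →
    Σ[ q ∈ Walk H u' v' ] len H q ≡ len H p
  substWalk refl refl p = p , refl

  distinct-triple⇒2≤len : ∀ {u v x y z} (p : Walk H u v) →
    x ∈ verts H p → y ∈ verts H p → z ∈ verts H p →
    x ≢ y → y ≢ z → x ≢ z → 2 ≤ len H p
  distinct-triple⇒2≤len (step _ (step _ _)) _ _ _ _ _ _ = s≤s (s≤s z≤n)
  distinct-triple⇒2≤len (here _) (here refl) (here refl) _ x≢y _ _ = contradiction refl x≢y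
  distinct-triple⇒2≤len (here _) (there ()) _ _ _ _ _
  distinct-triple⇒2≤len (here _) _ (there ()) _ _ _ _
  distinct-triple⇒2≤len (step _ (here _)) = two-vertices
    where
    two-vertices : ∀ {a b x y z} →
      x ∈ a ∷ b ∷ [] → y ∈ a ∷ b ∷ [] → z ∈ a ∷ b ∷ [] →
      x ≢ y → y ≢ z → x ≢ z → 2 ≤ 1
    two-vertices (here refl)         (here refl)         _ x≢y _ _ = contradiction refl x≢y
    two-vertices (there (here refl)) (there (here refl)) _ x≢y _ _ = contradiction refl x≢y
    two-vertices _ (here refl)         (here refl)         _ y≢z _ = contradiction refl y≢z
    two-vertices _ (there (here refl)) (there (here refl)) _ y≢z _ = contradiction refl y≢z
    two-vertices (here refl)         _ (here refl)         _ _ x≢z = contradiction refl x≢z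
    two-vertices (there (here refl)) _ (there (here refl)) _ _ x≢z = contradiction refl x≢z
    two-vertices (there (there ())) _ _ _ _ _
    two-vertices _ (there (there ())) _ _ _ _
    two-vertices _ _ (there (there ())) _ _ _

  GeneralPosition-⊆ : ∀ {S T} → S ⊆ T → GeneralPosition H T → GeneralPosition H S
  GeneralPosition-⊆ S⊆T gp x y z x∈S y∈S z∈S = gp x y z (S⊆T x∈S) (S⊆T y∈S) (S⊆T z∈S)

module Update {A B : Set} (_≟_ : DecidableEquality A) where

  update : (A → B) → A → B → A → B
  update f a b x with x ≟ a
  ... | yes _ = b
  ... | no  _ = f x

  update-≡ : ∀ f a b → update f a b a ≡ b
  update-≡ f a b with a ≟ a
  ... | yes _   = refl
  ... | no a≢a = contradiction refl a≢a

  update-≢ : ∀ f a b {x} → x ≢ a → update f a b x ≡ f x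
  update-≢ f a b {x} x≢a with x ≟ a
  ... | yes x≡a = contradiction x≡a x≢a
  ... | no  _   = refl

module Pairing {A : Set} (_≟_ : DecidableEquality A)
  (π : A → A) (π-involutive : ∀ x → π (π x) ≡ x) where

  Closed : List A → Set
  Closed S = ∀ {y} → y ∈ S → π y ∈ S

  OpenAt : A → List A → Set
  OpenAt u S = u ∈ S × π u ∉ S × (∀ {y} → y ∈ S → y ≢ u → π y ∈ S)

  π-injective : ∀ {x y} → π x ≡ π y → x ≡ y
  π-injective {x} {y} πx≡πy =
    trans (≡-sym (π-involutive x)) (trans (cong π πx≡πy) (π-involutive y))

  open-pair : ∀ {S y} → Closed S → y ∉ S → π y ≢ y → OpenAt y (y ∷ S)
  open-pair {S} {y} closed y∉S πy≢y = here refl , πy∉ , others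
    where
    πy∉ : π y ∉ y ∷ S
    πy∉ (here πy≡y)  = πy≢y πy≡y
    πy∉ (there πy∈S) = y∉S (subst (_∈ S) (π-involutive y) (closed πy∈S))
    others : ∀ {z} → z ∈ y ∷ S → z ≢ y → π z ∈ y ∷ S
    others (here z≡y)  z≢y = contradiction z≡y z≢y
    others (there z∈S) _   = there (closed z∈S)

  close-pair : ∀ {S u} → OpenAt u S → Closed (π u ∷ S)
  close-pair {S} {u} (u∈S , _ , _) (here refl) = there (subst (_∈ S) (≡-sym (π-involutive u)) u∈S)
  close-pair {S} {u} (u∈S , _ , others) {z} (there z∈S) with z ≟ u
  ... | yes refl = here refl
  ... | no  z≢u  = there (others z∈S z≢u)

  answer-closed : ∀ {S y} → Closed S → y ∉ S → π y ≢ y →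
    π y ∉ y ∷ S × Closed (π y ∷ y ∷ S)
  answer-closed closed y∉S πy≢y =
    let opened = open-pair closed y∉S πy≢y in proj₁ (proj₂ opened) , close-pair opened

  answer-open : ∀ {S u y} → OpenAt u S → y ∉ S → y ≢ π u → π y ≢ y →
    π y ∉ y ∷ S × OpenAt u (π y ∷ y ∷ S)
  answer-open {S} {u} {y} (u∈S , πu∉S , others) y∉S y≢πu πy≢y =
    πy∉ , there (there u∈S) , πu∉ , others′
    where
    πy∉ : π y ∉ y ∷ S
    πy∉ (here πy≡y)  = πy≢y πy≡y
    πy∉ (there πy∈S) with π y ≟ u
    ... | yes πy≡u = y≢πu (trans (≡-sym (π-involutive y)) (cong π πy≡u))
    ... | no  πy≢u = y∉S (subst (_∈ S) (π-involutive y) (others πy∈S πy≢u))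
    πu∉ : π u ∉ π y ∷ y ∷ S
    πu∉ (here πu≡πy)         = y∉S (subst (_∈ S) (π-injective πu≡πy) u∈S)
    πu∉ (there (here πu≡y))  = y≢πu (≡-sym πu≡y)
    πu∉ (there (there πu∈S)) = πu∉S πu∈S
    others′ : ∀ {z} → z ∈ π y ∷ y ∷ S → z ≢ u → π z ∈ π y ∷ y ∷ S
    others′ (here refl)         _   = there (here (π-involutive y))
    others′ (there (here refl)) _   = here refl
    others′ (there (there z∈S)) z≢u = there (there (others z∈S z≢u))

module MirrorStrategy {V : Set} (_≟_ : DecidableEquality V) (H : Graph V)
  (π : V → V) (π-involutive : ∀ x → π (π x) ≡ x) (π-fixedPointFree : ∀ x → π x ≢ x)
  (mirror-legal : ∀ {S y} → GeneralPosition H S → y ∈ S → π y ∉ S → Legal H S (π y)) where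

  open Pairing _≟_ π π-involutive

  closed⇒¬loses : ∀ {S} → Closed S → ¬ ToMoveLoses H S
  open⇒¬wins : ∀ {S u} → GeneralPosition H S → OpenAt u S → ¬ ToMoveWins H S

  closed⇒¬loses closed (allMoves (x , x-legal) next) =
    open⇒¬wins (proj₂ x-legal) (open-pair closed (proj₁ x-legal) (π-fixedPointFree x)) (next x x-legal)

  open⇒¬wins gp (u∈S , πu∉S , _) (noMove terminal) = terminal _ (mirror-legal gp u∈S πu∉S)
  open⇒¬wins {S} {u} gp opened (move y y-legal rest) with y ≟ π u
  ... | yes refl = closed⇒¬loses (close-pair opened) rest
  ... | no y≢πu with answer-open opened (proj₁ y-legal) y≢πu (π-fixedPointFree y) | rest
  ...   | πy∉ , opened′ | allMoves _ next =
    open⇒¬wins (proj₂ mirror) opened′ (next (π y) mirror)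
    where
    mirror : Legal H (y ∷ S) (π y)
    mirror = mirror-legal (proj₂ y-legal) (here refl) πy∉

  mirror⇒¬BWins : ¬ BWins H
  mirror⇒¬BWins = closed⇒¬loses (λ ())

module LexProduct {V : Set} (_≟_ : DecidableEquality V) (G : Graph V) (n : ℕ) where
  open Update {B = Fin n} _≟_

  P : Graph (V × Fin n)
  P = G ∘ₗ K n

  project : ∀ {x y} → Walk P x y → Walk G (proj₁ x) (proj₁ y)
  project (here x)                                 = here (proj₁ x)
  project (step (inj₁ e) p)                        = step e (project p)
  project {_ , _} (step {w = _ , _} (inj₂ (refl , _)) p) = project p

  len-project : ∀ {x y} (p : Walk P x y) → len G (project p) ≤ len P p
  len-project (here _)                                 = z≤n
  len-project (step (inj₁ _) p)                        = s≤s (len-project p)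
  len-project {_ , _} (step {w = _ , _} (inj₂ (refl , _)) p) = m≤n⇒m≤1+n (len-project p)

  ∈-project : ∀ {x y z} (p : Walk P x y) → z ∈ verts P p → proj₁ z ∈ verts G (project p)
  ∈-project (here _)          (here refl)  = here refl
  ∈-project (step (inj₁ _) _) (here refl)  = here refl
  ∈-project (step (inj₁ _) p) (there z∈p)  = there (∈-project p z∈p)
  ∈-project {_ , _} (step {w = _ , _} (inj₂ (refl , _)) p) (here refl) = start∈verts G (project p)
  ∈-project {_ , _} (step {w = _ , _} (inj₂ (refl , _)) p) (there z∈p) = ∈-project p z∈p

  lift : (t : V → Fin n) → ∀ {a b} → Walk G a b → Walk P (a , t a) (b , t b)
  lift t (here a)   = here (a , t a)
  lift t (step e p) = step (inj₁ e) (lift t p)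

  len-lift : ∀ t {a b} (p : Walk G a b) → len P (lift t p) ≡ len G p
  len-lift t (here _)   = refl
  len-lift t (step _ p) = cong suc (len-lift t p)

  ∈-lift : ∀ t {a b c} (p : Walk G a b) → c ∈ verts G p → (c , t c) ∈ verts P (lift t p)
  ∈-lift t (here _)   (here refl) = here refl
  ∈-lift t (step _ _) (here refl) = here refl
  ∈-lift t (step _ p) (there c∈p) = there (∈-lift t p c∈p)

  lift-geodesic : ∀ t {a b} (p : Walk G a b) → IsGeodesic G p → IsGeodesic P (lift t p)
  lift-geodesic t p p-geo q =
    ≤-trans (≤-reflexive (len-lift t p)) (≤-trans (p-geo (project q)) (len-project q))

  walkWithinFibre : ∀ {x y} → proj₁ x ≡ proj₁ y → Σ[ r ∈ Walk P x y ] len P r ≤ 1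
  walkWithinFibre {g , h} {_ , h'} refl with h Fin.≟ h'
  ... | yes refl = here (g , h) , z≤n
  ... | no  h≢h' = step (inj₂ (refl , h≢h')) (here (g , h')) , s≤s z≤n

  walkAcrossFibres : ∀ {x y} → proj₁ x ≢ proj₁ y → (q : Walk G (proj₁ x) (proj₁ y)) →
    Σ[ r ∈ Walk P x y ] len P r ≡ len G q
  walkAcrossFibres {g , h} {g' , h'} g≢g' q =
    map₂ (λ r≡ → trans r≡ (len-lift t q))
      (substWalk P (cong (g ,_) (update-≢ (λ _ → h) g' h' g≢g'))
                   (cong (g' ,_) (update-≡ (λ _ → h) g' h'))
        (lift t q))
    where
    t : V → Fin n
    t = update (λ _ → h) g' h'

  projectSuffix : ∀ {g u v y} → g ≡ proj₁ y → (p : Walk P u v) → y ∈ verts P p →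
    Σ[ q ∈ Walk G g (proj₁ v) ] len G q ≤ len P p
  projectSuffix refl p y∈p =
    let s , s≤p = suffix P p y∈p in project s , ≤-trans (len-project s) s≤p

  sameFibre⇒shortcut : ∀ {u v x y} (p : Walk P u v) → x ∈ verts P p → y ∈ verts P p →
    x ≢ y → proj₁ x ≡ proj₁ y → Σ[ q ∈ Walk G (proj₁ u) (proj₁ v) ] len G q < len P p
  sameFibre⇒shortcut (here _)   (here refl) (here refl) x≢y _ = contradiction refl x≢y
  sameFibre⇒shortcut (step _ _) (here refl) (here refl) x≢y _ = contradiction refl x≢y
  sameFibre⇒shortcut (step _ p) (here refl) (there y∈p) _ x≈y = map₂ s≤s (projectSuffix x≈y p y∈p)
  sameFibre⇒shortcut (step _ p) (there x∈p) (here refl) _ x≈y =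
    map₂ s≤s (projectSuffix (≡-sym x≈y) p x∈p)
  sameFibre⇒shortcut (step (inj₁ e) p) (there x∈p) (there y∈p) x≢y x≈y =
    let q , q<p = sameFibre⇒shortcut p x∈p y∈p x≢y x≈y in step e q , s≤s q<p
  sameFibre⇒shortcut {_ , _} (step {w = _ , _} (inj₂ (refl , _)) p) (there x∈p) (there y∈p) x≢y x≈y =
    map₂ m<n⇒m<1+n (sameFibre⇒shortcut p x∈p y∈p x≢y x≈y)
  sameFibre⇒shortcut (here _) (there ()) _ _ _
  sameFibre⇒shortcut (here _) _ (there ()) _ _

  geodesic-distinctEnds : ∀ {u v a b c} (p : Walk P u v) → IsGeodesic P p →
    a ∈ verts P p → b ∈ verts P p → c ∈ verts P p → a ≢ b → b ≢ c → a ≢ c →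
    proj₁ u ≢ proj₁ v
  geodesic-distinctEnds p p-geo a∈p b∈p c∈p a≢b b≢c a≢c u≈v =
    let q , q≤1 = walkWithinFibre u≈v in
    <-irrefl refl
      (≤-trans (distinct-triple⇒2≤len P p a∈p b∈p c∈p a≢b b≢c a≢c) (≤-trans (p-geo q) q≤1))

  sameFibre-¬onGeodesic : ∀ {u v a b c} (p : Walk P u v) → IsGeodesic P p →
    a ∈ verts P p → b ∈ verts P p → c ∈ verts P p → a ≢ b → b ≢ c → a ≢ c →
    proj₁ a ≢ proj₁ b
  sameFibre-¬onGeodesic p p-geo a∈p b∈p c∈p a≢b b≢c a≢c a≈b =
    let q , q<p = sameFibre⇒shortcut p a∈p b∈p a≢b a≈b
        r , r≡q = walkAcrossFibres (geodesic-distinctEnds p p-geo a∈p b∈p c∈p a≢b b≢c a≢c) q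
    in <⇒≱ q<p (≤-trans (p-geo r) (≤-reflexive r≡q))

  project-geodesic : ∀ {u v} (p : Walk P u v) → IsGeodesic P p → proj₁ u ≢ proj₁ v →
    IsGeodesic G (project p)
  project-geodesic p p-geo u≉v q =
    let r , r≡q = walkAcrossFibres u≉v q in
    ≤-trans (len-project p) (≤-trans (p-geo r) (≤-reflexive r≡q))

  onCommonGeodesic-lift : ∀ a b c → proj₁ a ≢ proj₁ b → proj₁ b ≢ proj₁ c → proj₁ a ≢ proj₁ c →
    OnCommonGeodesic G (proj₁ a) (proj₁ b) (proj₁ c) → OnCommonGeodesic P a b c
  onCommonGeodesic-lift (g₁ , h₁) (g₂ , h₂) (g₃ , h₃) g₁≢g₂ g₂≢g₃ g₁≢g₃
                        (u , v , p , p-geo , g₁∈p , g₂∈p , g₃∈p) =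
    (u , t u) , (v , t v) , lift t p , lift-geodesic t p p-geo ,
    through g₁∈p (update-≡ t₂ g₁ h₁) ,
    through g₂∈p (trans (update-≢ t₂ g₁ h₁ (g₁≢g₂ ∘ ≡-sym)) (update-≡ t₃ g₂ h₂)) ,
    through g₃∈p
      (trans (update-≢ t₂ g₁ h₁ (g₁≢g₃ ∘ ≡-sym)) (update-≢ t₃ g₂ h₂ (g₂≢g₃ ∘ ≡-sym)))
    where
    t₃ t₂ t : V → Fin n
    t₃ _ = h₃
    t₂ = update t₃ g₂ h₂
    t  = update t₂ g₁ h₁
    through : ∀ {g h} → g ∈ verts G p → t g ≡ h → (g , h) ∈ verts P (lift t p)
    through g∈p refl = ∈-lift t p g∈p

  shadow-gp⇒gp : ∀ {X} → GeneralPosition G (map proj₁ X) → GeneralPosition P X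
  shadow-gp⇒gp gp a b c a∈ b∈ c∈ a≢b b≢c a≢c (u , v , p , p-geo , a∈p , b∈p , c∈p)
    with proj₁ a ≟ proj₁ b | proj₁ b ≟ proj₁ c | proj₁ a ≟ proj₁ c
  ... | yes a≈b | _ | _ = sameFibre-¬onGeodesic p p-geo a∈p b∈p c∈p a≢b b≢c a≢c a≈b
  ... | _ | yes b≈c | _ =
    sameFibre-¬onGeodesic p p-geo b∈p c∈p a∈p b≢c (a≢c ∘ ≡-sym) (a≢b ∘ ≡-sym) b≈c
  ... | _ | _ | yes a≈c =
    sameFibre-¬onGeodesic p p-geo a∈p c∈p b∈p a≢c (b≢c ∘ ≡-sym) a≢b a≈c
  ... | no a≉b | no b≉c | no a≉c =
    gp _ _ _ (∈-map⁺ proj₁ a∈) (∈-map⁺ proj₁ b∈) (∈-map⁺ proj₁ c∈) a≉b b≉c a≉c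
      (proj₁ u , proj₁ v , project p ,
       project-geodesic p p-geo (geodesic-distinctEnds p p-geo a∈p b∈p c∈p a≢b b≢c a≢c) ,
       ∈-project p a∈p , ∈-project p b∈p , ∈-project p c∈p)

  gp⇒shadow-gp : ∀ {X} → GeneralPosition P X → GeneralPosition G (map proj₁ X)
  gp⇒shadow-gp gp x y z x∈ y∈ z∈ x≢y y≢z x≢z on-geo
    with ∈-map⁻ proj₁ x∈ | ∈-map⁻ proj₁ y∈ | ∈-map⁻ proj₁ z∈
  ... | a , a∈ , refl | b , b∈ , refl | c , c∈ , refl =
    gp a b c a∈ b∈ c∈ (x≢y ∘ cong proj₁) (y≢z ∘ cong proj₁) (x≢z ∘ cong proj₁)
      (onCommonGeodesic-lift a b c x≢y y≢z x≢z on-geo)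

  -- S Over T: T lists exactly the fibres met by S, i.e. T is the position S induces on G.
  _Over_ : List (V × Fin n) → List V → Set
  S Over T = map proj₁ S ⊆ T × T ⊆ map proj₁ S

  Over-∷-newFibre : ∀ {S T} y → S Over T → (y ∷ S) Over (proj₁ y ∷ T)
  Over-∷-newFibre y (S⊆T , T⊆S) = ∷⁺ʳ (proj₁ y) S⊆T , ∷⁺ʳ (proj₁ y) T⊆S

  Over-∷-oldFibre : ∀ {S T y} → proj₁ y ∈ T → S Over T → (y ∷ S) Over T
  Over-∷-oldFibre g∈T (S⊆T , T⊆S) = ∈-∷⁺ʳ g∈T S⊆T , λ g∈T → there (T⊆S g∈T)

  gp-∷-occupiedFibre : ∀ {S z} → proj₁ z ∈ map proj₁ S → GeneralPosition P S →
    GeneralPosition P (z ∷ S)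
  gp-∷-occupiedFibre g∈S gp =
    shadow-gp⇒gp (GeneralPosition-⊆ G (∈-∷⁺ʳ g∈S (λ g∈ → g∈)) (gp⇒shadow-gp gp))

  legal-newFibre⁺ : ∀ {S T y} → S Over T → Legal G T (proj₁ y) → Legal P S y
  legal-newFibre⁺ (S⊆T , _) (g∉T , gp) =
    (λ y∈S → g∉T (S⊆T (∈-map⁺ proj₁ y∈S))) ,
    shadow-gp⇒gp (GeneralPosition-⊆ G (∷⁺ʳ _ S⊆T) gp)

  legal-newFibre⁻ : ∀ {S T y} → S Over T → proj₁ y ∉ T → Legal P S y → Legal G T (proj₁ y)
  legal-newFibre⁻ (_ , T⊆S) g∉T (_ , gp) =
    g∉T , GeneralPosition-⊆ G (∷⁺ʳ _ T⊆S) (gp⇒shadow-gp gp)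

pairUp : ∀ {n} → Fin n → Fin n
pairUp {suc (suc _)} zero          = suc zero
pairUp {suc (suc _)} (suc zero)    = zero
pairUp {suc (suc _)} (suc (suc i)) = suc (suc (pairUp i))
pairUp {suc zero}    zero          = zero

pairUp-involutive : ∀ {n} (i : Fin n) → pairUp (pairUp i) ≡ i
pairUp-involutive {suc (suc _)} zero          = refl
pairUp-involutive {suc (suc _)} (suc zero)    = refl
pairUp-involutive {suc (suc _)} (suc (suc i)) = cong (Fin.suc ∘ Fin.suc) (pairUp-involutive i)
pairUp-involutive {suc zero}    zero          = refl

suc²-injective : ∀ {n} {i j : Fin n} → Fin.suc (suc i) ≡ suc (suc j) → i ≡ j
suc²-injective = Finₚ.suc-injective ∘ Finₚ.suc-injective

pairUp-fixed-unique : ∀ {n} (i j : Fin n) → pairUp i ≡ i → pairUp j ≡ j → i ≡ j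
pairUp-fixed-unique {suc zero}    zero          zero          _     _     = refl
pairUp-fixed-unique {suc (suc _)} (suc (suc i)) (suc (suc j)) i-fix j-fix =
  cong (Fin.suc ∘ Fin.suc) (pairUp-fixed-unique i j (suc²-injective i-fix) (suc²-injective j-fix))
pairUp-fixed-unique {suc (suc _)} zero       _          () _
pairUp-fixed-unique {suc (suc _)} (suc zero) _          () _
pairUp-fixed-unique {suc (suc _)} (suc (suc _)) zero       _ ()
pairUp-fixed-unique {suc (suc _)} (suc (suc _)) (suc zero) _ ()

Odd-2+ : ∀ {n} → Odd n → Odd (2 + n)
Odd-2+ (k , refl) = suc k , cong suc (≡-sym (*-suc 2 k))

Odd-2+⁻ : ∀ {n} → Odd (2 + n) → Odd n
Odd-2+⁻ (zero  , ())
Odd-2+⁻ (suc k , 2+n≡) = k , suc-injective (suc-injective (trans 2+n≡ (cong suc (*-suc 2 k))))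

pairUp-fixed⇒Odd : ∀ {n} (i : Fin n) → pairUp i ≡ i → Odd n
pairUp-fixed⇒Odd {suc zero}    zero          _     = 0 , refl
pairUp-fixed⇒Odd {suc (suc _)} (suc (suc i)) i-fix = Odd-2+ (pairUp-fixed⇒Odd i (suc²-injective i-fix))

Odd⇒pairUp-fixed : ∀ n → Odd n → ∃[ c ] pairUp {n} c ≡ c
Odd⇒pairUp-fixed zero          (_ , ())
Odd⇒pairUp-fixed (suc zero)    _     = zero , refl
Odd⇒pairUp-fixed (suc (suc n)) n-odd =
  let c , c-fix = Odd⇒pairUp-fixed n (Odd-2+⁻ n-odd) in suc (suc c) , cong (Fin.suc ∘ Fin.suc) c-fix

module PairFixing {n} (c : Fin n) (c-fixed : pairUp c ≡ c) where

  pairFixing : Fin n → Fin n → Fin n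
  pairFixing h k = transpose c h (pairUp (transpose h c k))

  transpose-first : ∀ (i j : Fin n) → transpose i j i ≡ j
  transpose-first i j rewrite dec-true (i Fin.≟ i) refl = refl

  pairFixing-involutive : ∀ h k → pairFixing h (pairFixing h k) ≡ k
  pairFixing-involutive h k = begin
    transpose c h (pairUp (transpose h c (transpose c h (pairUp (transpose h c k)))))
      ≡⟨ cong (transpose c h ∘ pairUp) (transpose-inverse h c) ⟩
    transpose c h (pairUp (pairUp (transpose h c k)))
      ≡⟨ cong (transpose c h) (pairUp-involutive _) ⟩
    transpose c h (transpose h c k)
      ≡⟨ transpose-inverse c h ⟩
    k ∎
    where open ≡-Reasoning

  pairFixing-fixes : ∀ h → pairFixing h h ≡ h
  pairFixing-fixes h = begin
    transpose c h (pairUp (transpose h c h)) ≡⟨ cong (transpose c h ∘ pairUp) (transpose-first h c) ⟩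
    transpose c h (pairUp c)                 ≡⟨ cong (transpose c h) c-fixed ⟩
    transpose c h c                          ≡⟨ transpose-first c h ⟩
    h ∎
    where open ≡-Reasoning

  pairFixing-fixed⇒ : ∀ h k → pairFixing h k ≡ k → k ≡ h
  pairFixing-fixed⇒ h k k-fix = begin
    k                             ≡⟨ transpose-inverse c h ⟨
    transpose c h (transpose h c k) ≡⟨ cong (transpose c h) (pairUp-fixed-unique _ c k′-fix c-fixed) ⟩
    transpose c h c               ≡⟨ transpose-first c h ⟩
    h ∎
    where
    open ≡-Reasoning
    k′-fix : pairUp (transpose h c k) ≡ transpose h c k
    k′-fix = trans (≡-sym (transpose-inverse h c)) (cong (transpose h c) k-fix)

module Outside {A : Set} (_≟_ : DecidableEquality A) where
  open DecMembership _≟_ using (_∈?_)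

  tally : ∀ {Q : Set} → Dec Q → ℕ → ℕ
  tally (yes _) k = k
  tally (no  _) k = suc k

  outside : List A → List A → ℕ
  outside S []      = 0
  outside S (x ∷ L) = tally (x ∈? S) (outside S L)

  tally-∷-≤ : ∀ {x y : A} {S a b} (d : Dec (x ∈ y ∷ S)) (d′ : Dec (x ∈ S)) →
    a ≤ b → tally d a ≤ tally d′ b
  tally-∷-≤ (yes _) (yes _)   a≤b = a≤b
  tally-∷-≤ (yes _) (no  _)   a≤b = m≤n⇒m≤1+n a≤b
  tally-∷-≤ (no x∉) (yes x∈S) _   = contradiction (there x∈S) x∉
  tally-∷-≤ (no _)  (no  _)   a≤b = s≤s a≤b

  tally-∷-< : ∀ {x y : A} {S a b} (d : Dec (x ∈ y ∷ S)) (d′ : Dec (x ∈ S)) →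
    y ∉ S → a ≤ b → x ≡ y ⊎ a < b → tally d a < tally d′ b
  tally-∷-< (yes _) (yes x∈S) y∉S _   (inj₁ refl) = contradiction x∈S y∉S
  tally-∷-< (yes _) (yes _)   _   _   (inj₂ a<b)  = a<b
  tally-∷-< (yes _) (no  _)   _   a≤b _           = s≤s a≤b
  tally-∷-< (no x∉) (yes x∈S) _   _   _           = contradiction (there x∈S) x∉
  tally-∷-< (no x∉) (no  _)   _   _   (inj₁ refl) = contradiction (here refl) x∉
  tally-∷-< (no _)  (no  _)   _   _   (inj₂ a<b)  = s≤s a<b

  outside-∷-≤ : ∀ y S L → outside (y ∷ S) L ≤ outside S L
  outside-∷-≤ y S []      = z≤n
  outside-∷-≤ y S (x ∷ L) = tally-∷-≤ (x ∈? y ∷ S) (x ∈? S) (outside-∷-≤ y S L)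

  outside-∷-< : ∀ {y S L} → y ∈ L → y ∉ S → outside (y ∷ S) L < outside S L
  outside-∷-< {y} {S} {x ∷ L} y∈ y∉S =
    tally-∷-< (x ∈? y ∷ S) (x ∈? S) y∉S (outside-∷-≤ y S L) (head-or-tail y∈)
    where
    head-or-tail : y ∈ x ∷ L → x ≡ y ⊎ outside (y ∷ S) L < outside S L
    head-or-tail (here refl)  = inj₁ refl
    head-or-tail (there y∈L) = inj₂ (outside-∷-< y∈L y∉S)

Terminal : ∀ {V} → Graph V → List V → Set
Terminal H S = ∀ v → ¬ Legal H S v

module OddTransfer {V : Set} (_≟_ : DecidableEquality V)
  (vertices : List V) (∈-vertices : ∀ v → v ∈ vertices) (G : Graph V) (n : ℕ)
  (pairFixing : Fin n → Fin n → Fin n)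
  (pairFixing-involutive : ∀ h k → pairFixing h (pairFixing h k) ≡ k)
  (pairFixing-fixed⇒ : ∀ h k → pairFixing h k ≡ k → k ≡ h)
  (pairFixing-fixes : ∀ h → pairFixing h h ≡ h)
  (h₀ : Fin n) where

  open LexProduct _≟_ G n
  open Update {B = Fin n} _≟_
  open DecMembership _≟_ using () renaming (_∈?_ to _∈ᴳ?_)

  _≟ᴾ_ : DecidableEquality (V × Fin n)
  _≟ᴾ_ = ≡-dec _≟_ Fin._≟_

  open DecMembership _≟ᴾ_ using () renaming (_∈?_ to _∈ᴾ?_)
  open Outside _≟ᴾ_

  allVertices : List (V × Fin n)
  allVertices = cartesianProduct vertices (allFin n)

  ∈-allVertices : ∀ y → y ∈ allVertices
  ∈-allVertices (g , h) = ∈-cartesianProduct⁺ (∈-vertices g) (∈-allFin h)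

  μ : List (V × Fin n) → ℕ
  μ S = outside S allVertices

  μ-∷-< : ∀ {y S} → y ∉ S → μ (y ∷ S) < μ S
  μ-∷-< {y} y∉S = outside-∷-< (∈-allVertices y) y∉S

  μ-∷∷-< : ∀ {z y S} → y ∉ S → μ (z ∷ y ∷ S) < μ S
  μ-∷∷-< {z} {y} {S} y∉S = ≤-<-trans (outside-∷-≤ z (y ∷ S) allVertices) (μ-∷-< y∉S)

  Opener : Set
  Opener = V → Fin n

  -- o g is the opener of fibre g, the first vertex played in it: partner o fixes it and
  -- pairs up the rest of the fibre.
  partner : Opener → V × Fin n → V × Fin n
  partner o (g , h) = g , pairFixing (o g) h

  partner-involutive : ∀ o y → partner o (partner o y) ≡ y
  partner-involutive o (g , h) = cong (g ,_) (pairFixing-involutive (o g) h)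

  module Partners (o : Opener) = Pairing _≟ᴾ_ (partner o) (partner-involutive o)
  open Partners

  record Tracks (o : Opener) (S : List (V × Fin n)) (T : List V) : Set where
    field
      general : GeneralPosition P S
      openers : ∀ {g} → g ∈ T → (g , o g) ∈ S
      over    : S Over T
  open Tracks

  Paired : Opener → List (V × Fin n) → List V → Set
  Paired o S T = Closed o S × Tracks o S T

  PairedBut : Opener → V × Fin n → List (V × Fin n) → List V → Set
  PairedBut o u S T = OpenAt o u S × Tracks o S T

  partner-≢ : ∀ {o S T y} → Tracks o S T → y ∉ S → proj₁ y ∈ T → partner o y ≢ y
  partner-≢ {y = g , h} tr y∉S g∈T y-fixed =
    y∉S (subst (λ k → (g , k) ∈ _) (≡-sym (pairFixing-fixed⇒ _ h (cong proj₂ y-fixed)))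
               (openers tr g∈T))

  Tracks-∷-oldFibre : ∀ {o S T y} → proj₁ y ∈ T → Tracks o S T → Tracks o (y ∷ S) T
  Tracks-∷-oldFibre {y = y} g∈T tr = record
    { general = gp-∷-occupiedFibre (proj₂ (over tr) g∈T) (general tr)
    ; openers = λ g′∈T → there (openers tr g′∈T)
    ; over    = Over-∷-oldFibre {y = y} g∈T (over tr)
    }

  Paired-∷-newFibre : ∀ {o S T y} → Paired o S T → proj₁ y ∉ T → GeneralPosition P (y ∷ S) →
    Paired (update o (proj₁ y) (proj₂ y)) (y ∷ S) (proj₁ y ∷ T)
  Paired-∷-newFibre {o} {S} {T} {y@(g , h)} (closed , tr) g∉T gp =
    closed′ , record { general = gp ; openers = openers′ ; over = Over-∷-newFibre y (over tr) }
    where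
    o′ : Opener
    o′ = update o g h
    unchanged : ∀ {g′} → g′ ∈ T → o′ g′ ≡ o g′
    unchanged g′∈T = update-≢ o g h (λ g′≡g → g∉T (subst (_∈ T) g′≡g g′∈T))
    closed′ : Closed o′ (y ∷ S)
    closed′ (here refl) =
      here (cong (g ,_) (trans (cong (λ k → pairFixing k h) (update-≡ o g h)) (pairFixing-fixes h)))
    closed′ {z} (there z∈S) =
      there (subst (λ k → (proj₁ z , pairFixing k (proj₂ z)) ∈ S)
                   (≡-sym (unchanged (proj₁ (over tr) (∈-map⁺ proj₁ z∈S)))) (closed z∈S))
    openers′ : ∀ {g′} → g′ ∈ g ∷ T → (g′ , o′ g′) ∈ y ∷ S
    openers′ (here refl)  = here (cong (g ,_) (update-≡ o g h))
    openers′ (there g′∈T) =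
      there (subst (λ k → (_ , k) ∈ S) (≡-sym (unchanged g′∈T)) (openers tr g′∈T))

  open-legal : ∀ {o S T y} → Paired o S T → y ∉ S → proj₁ y ∈ T →
    Legal P S y × PairedBut o y (y ∷ S) T
  open-legal {o} (closed , tr) y∉S g∈T =
    (y∉S , general tr′) , open-pair o closed y∉S (partner-≢ tr y∉S g∈T) , tr′
    where tr′ = Tracks-∷-oldFibre g∈T tr

  close-legal : ∀ {o u S T} → PairedBut o u S T →
    Legal P S (partner o u) × Paired o (partner o u ∷ S) T
  close-legal {o} opened@((u∈S , πu∉S , _) , tr) =
    (πu∉S , general tr′) , close-pair o (proj₁ opened) , tr′
    where tr′ = Tracks-∷-oldFibre (proj₁ (over tr) (∈-map⁺ proj₁ u∈S)) tr

  answer-closed-legal : ∀ {o S T y} → Paired o S T → y ∉ S → proj₁ y ∈ T →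
    Legal P (y ∷ S) (partner o y) × Paired o (partner o y ∷ y ∷ S) T
  answer-closed-legal {o} (closed , tr) y∉S g∈T =
    let πy∉ , closed′ = answer-closed o closed y∉S (partner-≢ tr y∉S g∈T)
        tr′ = Tracks-∷-oldFibre g∈T (Tracks-∷-oldFibre g∈T tr)
    in (πy∉ , general tr′) , closed′ , tr′

  answer-open-legal : ∀ {o u S T y} → PairedBut o u S T →
    y ∉ S → proj₁ y ∈ T → y ≢ partner o u →
    Legal P (y ∷ S) (partner o y) × PairedBut o u (partner o y ∷ y ∷ S) T
  answer-open-legal {o} (opened , tr) y∉S g∈T y≢πu =
    let πy∉ , opened′ = answer-open o opened y∉S y≢πu (partner-≢ tr y∉S g∈T)
        tr′ = Tracks-∷-oldFibre g∈T (Tracks-∷-oldFibre g∈T tr)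
    in (πy∉ , general tr′) , opened′ , tr′

  -- Answers inside occupied fibres leave the position on G unchanged, so the recursion
  -- descends on the number μ S of unplayed vertices.
  winsᴳ⇒winsᴾ : ∀ {o S T} → ToMoveWins G T → Paired o S T → Acc _<_ (μ S) → ToMoveWins P S
  losesᴳ⇒losesᴾ : ∀ {o S T} → ToMoveLoses G T → Paired o S T → Acc _<_ (μ S) → ToMoveLoses P S
  losesᴳ⇒replyᴾ : ∀ {o S T} → ToMoveLoses G T → Paired o S T → Acc _<_ (μ S) →
    ∀ x → Legal P S x → ToMoveWins P (x ∷ S)
  terminal⇒winsᴾ : ∀ {o S T} → Terminal G T → Paired o S T → Acc _<_ (μ S) → ToMoveWins P S
  terminal⇒losesᴾ : ∀ {o u S T} → Terminal G T → PairedBut o u S T → Acc _<_ (μ S) →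
    ToMoveLoses P S
  terminal⇒replyᴾ : ∀ {o u S T} → Terminal G T → PairedBut o u S T → Acc _<_ (μ S) →
    ∀ x → Legal P S x → ToMoveWins P (x ∷ S)

  winsᴳ⇒winsᴾ (noMove terminal) paired ac = terminal⇒winsᴾ terminal paired ac
  winsᴳ⇒winsᴾ {S = S} (move v v-legal rest) paired (acc rs) =
    move (v , h₀) y-legal
      (losesᴳ⇒losesᴾ rest (Paired-∷-newFibre paired (proj₁ v-legal) (proj₂ y-legal))
                          (rs (μ-∷-< (proj₁ y-legal))))
    where
    y-legal : Legal P S (v , h₀)
    y-legal = legal-newFibre⁺ (over (proj₂ paired)) v-legal

  losesᴳ⇒losesᴾ loses@(allMoves (v , v-legal) _) paired ac =
    allMoves ((v , h₀) , legal-newFibre⁺ (over (proj₂ paired)) v-legal)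
             (losesᴳ⇒replyᴾ loses paired ac)

  losesᴳ⇒replyᴾ {T = T} loses@(allMoves _ next) paired (acc rs) x x-legal with proj₁ x ∈ᴳ? T
  ... | no g∉T =
    winsᴳ⇒winsᴾ (next _ (legal-newFibre⁻ (over (proj₂ paired)) g∉T x-legal))
      (Paired-∷-newFibre paired g∉T (proj₂ x-legal)) (rs (μ-∷-< (proj₁ x-legal)))
  ... | yes g∈T =
    let z-legal , paired′ = answer-closed-legal paired (proj₁ x-legal) g∈T
    in move _ z-legal (losesᴳ⇒losesᴾ loses paired′ (rs (μ-∷∷-< (proj₁ x-legal))))

  terminal⇒winsᴾ {S = S} {T} terminal paired (acc rs)
    with anyᴸ? (λ y → ¬? (y ∈ᴾ? S) ×-dec (proj₁ y ∈ᴳ? T)) allVertices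
  ... | yes found =
    let y , y∉S , g∈T = satisfied found
        y-legal , opened = open-legal paired y∉S g∈T
    in move y y-legal (terminal⇒losesᴾ terminal opened (rs (μ-∷-< y∉S)))
  ... | no none = noMove no-legal
    where
    no-legal : ∀ x → ¬ Legal P S x
    no-legal x x-legal with proj₁ x ∈ᴳ? T
    ... | yes g∈T = none (lose (∈-allVertices x) (proj₁ x-legal , g∈T))
    ... | no  g∉T = terminal (proj₁ x) (legal-newFibre⁻ (over (proj₂ paired)) g∉T x-legal)

  terminal⇒losesᴾ terminal opened ac =
    allMoves (_ , proj₁ (close-legal opened)) (terminal⇒replyᴾ terminal opened ac)

  terminal⇒replyᴾ {o} {u} {T = T} terminal opened (acc rs) x x-legal with proj₁ x ∈ᴳ? T
  ... | no g∉T =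
    contradiction (legal-newFibre⁻ (over (proj₂ opened)) g∉T x-legal) (terminal (proj₁ x))
  ... | yes g∈T with x ≟ᴾ partner o u
  ...   | yes refl =
    terminal⇒winsᴾ terminal (proj₂ (close-legal opened)) (rs (μ-∷-< (proj₁ x-legal)))
  ...   | no x≢πu =
    let z-legal , opened′ = answer-open-legal opened (proj₁ x-legal) g∈T x≢πu
    in move _ z-legal (terminal⇒losesᴾ terminal opened′ (rs (μ-∷∷-< (proj₁ x-legal))))

  winsᴾ⇒winsᴳ : ∀ {o S T} → ToMoveWins P S → Paired o S T → ToMoveWins G T
  losesᴾ⇒losesᴳ : ∀ {o S T} → ToMoveLoses P S → Paired o S T → ToMoveLoses G T
  losesᴾ⇒moveᴳ : ∀ {o S T} → ToMoveLoses P S → Paired o S T → ∃[ v ] Legal G T v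
  winsᴾ⇒moveᴳ : ∀ {o u S T} → ToMoveWins P S → PairedBut o u S T → ∃[ v ] Legal G T v

  winsᴾ⇒winsᴳ (noMove terminal) paired =
    noMove λ v v-legal → terminal (v , h₀) (legal-newFibre⁺ (over (proj₂ paired)) v-legal)
  winsᴾ⇒winsᴳ {T = T} (move y y-legal rest) paired with proj₁ y ∈ᴳ? T | rest
  ... | no g∉T | loses =
    move (proj₁ y) (legal-newFibre⁻ (over (proj₂ paired)) g∉T y-legal)
      (losesᴾ⇒losesᴳ loses (Paired-∷-newFibre paired g∉T (proj₂ y-legal)))
  ... | yes g∈T | allMoves _ next =
    let z-legal , paired′ = answer-closed-legal paired (proj₁ y-legal) g∈T
    in winsᴾ⇒winsᴳ (next _ z-legal) paired′

  losesᴾ⇒losesᴳ loses@(allMoves _ next) paired =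
    allMoves (losesᴾ⇒moveᴳ loses paired) λ v v-legal →
      let y-legal = legal-newFibre⁺ (over (proj₂ paired)) v-legal
      in winsᴾ⇒winsᴳ (next (v , h₀) y-legal)
                     (Paired-∷-newFibre paired (proj₁ v-legal) (proj₂ y-legal))

  losesᴾ⇒moveᴳ {T = T} (allMoves (x , x-legal) next) paired with proj₁ x ∈ᴳ? T
  ... | no g∉T  = proj₁ x , legal-newFibre⁻ (over (proj₂ paired)) g∉T x-legal
  ... | yes g∈T = winsᴾ⇒moveᴳ (next x x-legal) (proj₂ (open-legal paired (proj₁ x-legal) g∈T))

  winsᴾ⇒moveᴳ (noMove terminal) opened = contradiction (proj₁ (close-legal opened)) (terminal _)
  winsᴾ⇒moveᴳ {o} {u} {T = T} (move y y-legal rest) opened with proj₁ y ∈ᴳ? T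
  ... | no g∉T = proj₁ y , legal-newFibre⁻ (over (proj₂ opened)) g∉T y-legal
  ... | yes g∈T with y ≟ᴾ partner o u | rest
  ...   | yes refl | loses = losesᴾ⇒moveᴳ loses (proj₂ (close-legal opened))
  ...   | no y≢πu | allMoves _ next =
    let z-legal , opened′ = answer-open-legal opened (proj₁ y-legal) g∈T y≢πu
    in winsᴾ⇒moveᴳ (next _ z-legal) opened′

  start : Paired (λ _ → h₀) [] []
  start = (λ ()) , record { general = λ _ _ _ () ; openers = λ () ; over = (λ ()) , (λ ()) }

  BWins⁺ : BWins G → BWins P
  BWins⁺ b = losesᴳ⇒losesᴾ b start (<-wellFounded _)

  BWins⁻ : BWins P → BWins G
  BWins⁻ b = losesᴾ⇒losesᴳ b start

module _ {V : Set} (_≟_ : DecidableEquality V) (G : Graph V) (n : ℕ) where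

  open LexProduct _≟_ G n

  pairUp-fixedPointFree⇒¬BWins : (∀ i → pairUp {n} i ≢ i) → ¬ BWins P
  pairUp-fixedPointFree⇒¬BWins no-fixed =
    MirrorStrategy.mirror⇒¬BWins (≡-dec _≟_ Fin._≟_) P π π-involutive
      (λ y → no-fixed (proj₂ y) ∘ cong proj₂)
      (λ gp y∈S πy∉S → πy∉S , gp-∷-occupiedFibre (∈-map⁺ proj₁ y∈S) gp)
    where
    π : V × Fin n → V × Fin n
    π (g , h) = g , pairUp h
    π-involutive : ∀ y → π (π y) ≡ y
    π-involutive (g , h) = cong (g ,_) (pairUp-involutive h)

  pairUp-fixed⇒BWins⇔ : (vertices : List V) → (∀ v → v ∈ vertices) →
    (c : Fin n) → pairUp c ≡ c → BWins P ⇔ BWins G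
  pairUp-fixed⇒BWins⇔ vertices ∈-vertices c c-fixed = mk⇔ BWins⁻ BWins⁺
    where
    open PairFixing c c-fixed
    open OddTransfer _≟_ vertices ∈-vertices G n pairFixing pairFixing-involutive
      pairFixing-fixed⇒ pairFixing-fixes c

theorem5p4 : (m : ℕ) (G : Graph (Fin m)) → Connected G → (n : ℕ) → 1 ≤ n →
    (BWins (G ∘ₗ K n) ⇔ (BWins G × Odd n))
theorem5p4 m G _ n _ = mk⇔ to from
  where
  lexGame⇔ : (c : Fin n) → pairUp c ≡ c → BWins (G ∘ₗ K n) ⇔ BWins G
  lexGame⇔ = pairUp-fixed⇒BWins⇔ Fin._≟_ G n (allFin m) ∈-allFin

  to : BWins (G ∘ₗ K n) → BWins G × Odd n
  to b with Finₚ.any? (λ i → pairUp i Fin.≟ i)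
  ... | yes (c , c-fixed) = Equivalence.to (lexGame⇔ c c-fixed) b , pairUp-fixed⇒Odd c c-fixed
  ... | no  no-fixed      =
    ⊥-elim (pairUp-fixedPointFree⇒¬BWins Fin._≟_ G n (λ i i-fixed → no-fixed (i , i-fixed)) b)

  from : BWins G × Odd n → BWins (G ∘ₗ K n)
  from (b , n-odd) =
    let c , c-fixed = Odd⇒pairUp-fixed n n-odd in Equivalence.from (lexGame⇔ c c-fixed) b
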